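{- Let $Q_2(x,y,z)=x^2+2y^2+2yz+2z^2$. If $m=4^k(8\ell+5)$ for integers $k\ge 0$ and $\ell$, then $m$ is not represented by $Q_2$.
   Context: An integer $n$ is represented by a form $Q(x,y,z)$ if there exist integers $x,y,z$ with $Q(x,y,z)=n$. -}

module Defs where

open import Data.Integer using (ℤ; +_; _+_; _*_)
open import Data.Nat using (ℕ)
import Data.Nat as ℕ
open import Data.Product using (∃-syntax; _×_)
open import Relation.Binary.PropositionalEquality using (_≡_)

Q₂ : ℤ → ℤ → ℤ → ℤ
Q₂ x y z = x * x + + 2 * (y * y) + + 2 * (y * z) + + 2 * (z * z)

RepresentedByQ₂ : ℤ → Set
RepresentedByQ₂ n = ∃[ x ] ∃[ y ] ∃[ z ] Q₂ x y z ≡ n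

{-# OPTIONS --safe #-}
-- With the polar form B₂ of Q₂ one has Q₂(v + 2m·w) = Q₂(v) + 4m·(B₂(v,w) + m·Q₂(w)), so Q₂ modulo 4m
-- only depends on v modulo 2m. Hence Q₂ mod 8 is determined by the residues mod 4, and a finite check
-- shows it is never 5. Likewise Q₂ ≡ 0 mod 4 forces x, y, z to be even, and then Q₂(v) = 4·Q₂(v/2):
-- this descent strips the factors of 4 one at a time.
module Submission where

open import Defs
open import Data.Nat using (ℕ; _^_)
open import Data.Integer using (ℤ; +_; _+_; _*_)
open import Relation.Nullary using (¬_)

import Data.Nat as ℕ
import Data.Nat.Divisibility as ℕ
open import Data.Integer using (-_; _-_; ∣_∣; _/ℕ_)
open import Data.Integer.Properties using (pos-*; *-assoc; *-identityˡ; +-identityˡ; *-cancelˡ-≡)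
open import Data.Integer.DivMod using (n%ℕd<d; a≡a%ℕn+[a/ℕn]*n)
open import Data.Integer.Divisibility.Signed
  using (_∣_; divides; ∣⇒∣ᵤ; ∣-refl; ∣m∣n⇒∣m+n; ∣m⇒∣-m; ∣m+n∣n⇒∣m; ∣m⇒∣m*n)
open import Data.Integer.Tactic.RingSolver using (solve-∀)
open import Data.Fin using (Fin; toℕ; fromℕ<)
open import Data.Fin.Properties using (all?; toℕ-fromℕ<)
open import Data.Product using (∃-syntax; _,_; _×_)
open import Relation.Binary.PropositionalEquality
open import Relation.Nullary.Decidable using (toWitness; ¬?; _→-dec_; _×-dec_)
open import Data.Unit using (tt)

∣x-y⇒x≡y+q*k : ∀ {k x y} → k ∣ x - y → ∃[ q ] x ≡ y + q * k
∣x-y⇒x≡y+q*k {k} {x} {y} (divides q x-y≡q*k) = q , (begin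
  x             ≡⟨ identity x y ⟩
  y + (x - y)   ≡⟨ cong (λ d → y + d) x-y≡q*k ⟩
  y + q * k     ∎)
  where
  open ≡-Reasoning
  identity : ∀ (x y : ℤ) → x ≡ y + (x - y)
  identity = solve-∀

∣x-y⇒∣y-z⇒∣x-z : ∀ {k x y z} → k ∣ x - y → k ∣ y - z → k ∣ x - z
∣x-y⇒∣y-z⇒∣x-z {k} {x} {y} {z} k∣x-y k∣y-z =
  subst (k ∣_) (identity x y z) (∣m∣n⇒∣m+n k∣x-y k∣y-z)
  where
  identity : ∀ (x y z : ℤ) → x - y + (y - z) ≡ x - z
  identity = solve-∀

residue : (d : ℕ) .{{_ : ℕ.NonZero d}} → ℤ → Fin d
residue d x = fromℕ< (n%ℕd<d x d)

x≡residue+quotient : ∀ d .{{_ : ℕ.NonZero d}} x → x ≡ + toℕ (residue d x) + (x /ℕ d) * + d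
x≡residue+quotient d x rewrite toℕ-fromℕ< (n%ℕd<d x d) = a≡a%ℕn+[a/ℕn]*n x d

∣residue-x : ∀ d .{{_ : ℕ.NonZero d}} x → + d ∣ + toℕ (residue d x) - x
∣residue-x d x = divides (- (x /ℕ d)) (begin
  r - x                      ≡⟨ cong (λ x′ → r - x′) (x≡residue+quotient d x) ⟩
  r - (r + (x /ℕ d) * + d)   ≡⟨ identity r (x /ℕ d) (+ d) ⟩
  - (x /ℕ d) * + d           ∎)
  where
  open ≡-Reasoning
  r = + toℕ (residue d x)
  identity : ∀ (r q d : ℤ) → r - (r + q * d) ≡ - q * d
  identity = solve-∀

residue≡0⇒x≡quotient*d : ∀ d .{{_ : ℕ.NonZero d}} x → toℕ (residue d x) ≡ 0 → x ≡ (x /ℕ d) * + d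
residue≡0⇒x≡quotient*d d x r≡0 = begin
  x                                      ≡⟨ x≡residue+quotient d x ⟩
  + toℕ (residue d x) + (x /ℕ d) * + d   ≡⟨ cong (λ r → + r + (x /ℕ d) * + d) r≡0 ⟩
  + 0 + (x /ℕ d) * + d                   ≡⟨ +-identityˡ _ ⟩
  (x /ℕ d) * + d                         ∎
  where open ≡-Reasoning

B₂ : ℤ → ℤ → ℤ → ℤ → ℤ → ℤ → ℤ
B₂ x y z x′ y′ z′ = x * x′ + + 2 * (y * y′) + y * z′ + z * y′ + + 2 * (z * z′)

Q₂-+-even-multiple : ∀ m x y z x′ y′ z′ →
  Q₂ (x + x′ * (+ 2 * m)) (y + y′ * (+ 2 * m)) (z + z′ * (+ 2 * m))
    ≡ Q₂ x y z + (B₂ x y z x′ y′ z′ + m * Q₂ x′ y′ z′) * (+ 4 * m)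
Q₂-+-even-multiple = identity
  where
  -- solve-∀ does not unfold Q₂ and B₂, so the identity is stated with both expanded.
  identity : ∀ (m x y z x′ y′ z′ : ℤ) →
    let n = + 2 * m; X = x + x′ * n; Y = y + y′ * n; Z = z + z′ * n in
    X * X + + 2 * (Y * Y) + + 2 * (Y * Z) + + 2 * (Z * Z)
      ≡ x * x + + 2 * (y * y) + + 2 * (y * z) + + 2 * (z * z)
        + (x * x′ + + 2 * (y * y′) + y * z′ + z * y′ + + 2 * (z * z′)
           + m * (x′ * x′ + + 2 * (y′ * y′) + + 2 * (y′ * z′) + + 2 * (z′ * z′))) * (+ 4 * m)
  identity = solve-∀

Q₂-*2 : ∀ x y z → Q₂ (x * + 2) (y * + 2) (z * + 2) ≡ + 4 * Q₂ x y z
Q₂-*2 = identity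
  where
  identity : ∀ (x y z : ℤ) →
    x * + 2 * (x * + 2) + + 2 * (y * + 2 * (y * + 2))
      + + 2 * (y * + 2 * (z * + 2)) + + 2 * (z * + 2 * (z * + 2))
      ≡ + 4 * (x * x + + 2 * (y * y) + + 2 * (y * z) + + 2 * (z * z))
  identity = solve-∀

Q₂-cong : ∀ m x y z x′ y′ z′ → + 2 * m ∣ x - x′ → + 2 * m ∣ y - y′ → + 2 * m ∣ z - z′ →
          + 4 * m ∣ Q₂ x y z - Q₂ x′ y′ z′
Q₂-cong m x y z x′ y′ z′ 2m∣x-x′ 2m∣y-y′ 2m∣z-z′
  with a , refl ← ∣x-y⇒x≡y+q*k {x = x} {x′} 2m∣x-x′
     | b , refl ← ∣x-y⇒x≡y+q*k {x = y} {y′} 2m∣y-y′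
     | c , refl ← ∣x-y⇒x≡y+q*k {x = z} {z′} 2m∣z-z′ =
  divides (B₂ x′ y′ z′ a b c + m * Q₂ a b c) (begin
    Q₂ (x′ + a * (+ 2 * m)) (y′ + b * (+ 2 * m)) (z′ + c * (+ 2 * m)) - Q₂ x′ y′ z′
      ≡⟨ cong (_- Q₂ x′ y′ z′) (Q₂-+-even-multiple m x′ y′ z′ a b c) ⟩
    Q₂ x′ y′ z′ + (B₂ x′ y′ z′ a b c + m * Q₂ a b c) * (+ 4 * m) - Q₂ x′ y′ z′
      ≡⟨ cancel (Q₂ x′ y′ z′) _ ⟩
    (B₂ x′ y′ z′ a b c + m * Q₂ a b c) * (+ 4 * m) ∎)
  where
  open ≡-Reasoning
  cancel : ∀ (u v : ℤ) → u + v - u ≡ v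
  cancel = solve-∀

Q₂-mod8≢5 : ∀ (r s t : Fin 4) → ¬ (+ 8 ∣ Q₂ (+ toℕ r) (+ toℕ s) (+ toℕ t) - + 5)
Q₂-mod8≢5 r s t 8∣ = table r s t (∣⇒∣ᵤ 8∣)
  where
  table : ∀ (r s t : Fin 4) → ¬ (8 ℕ.∣ ∣ Q₂ (+ toℕ r) (+ toℕ s) (+ toℕ t) - + 5 ∣)
  table = toWitness {a? = all? λ r → all? λ s → all? λ t →
    ¬? (8 ℕ.∣? ∣ Q₂ (+ toℕ r) (+ toℕ s) (+ toℕ t) - + 5 ∣)} tt

Q₂-mod4≡0⇒zero : ∀ (r s t : Fin 2) → + 4 ∣ Q₂ (+ toℕ r) (+ toℕ s) (+ toℕ t) →
                 toℕ r ≡ 0 × toℕ s ≡ 0 × toℕ t ≡ 0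
Q₂-mod4≡0⇒zero r s t 4∣ = table r s t (∣⇒∣ᵤ 4∣)
  where
  table : ∀ (r s t : Fin 2) → 4 ℕ.∣ ∣ Q₂ (+ toℕ r) (+ toℕ s) (+ toℕ t) ∣ →
          toℕ r ≡ 0 × toℕ s ≡ 0 × toℕ t ≡ 0
  table = toWitness {a? = all? λ r → all? λ s → all? λ t →
    (4 ℕ.∣? ∣ Q₂ (+ toℕ r) (+ toℕ s) (+ toℕ t) ∣) →-dec
    ((toℕ r ℕ.≟ 0) ×-dec (toℕ s ℕ.≟ 0) ×-dec (toℕ t ℕ.≟ 0))} tt

Q₂≢8ℓ+5 : ∀ ℓ x y z → Q₂ x y z ≢ + 8 * ℓ + + 5
Q₂≢8ℓ+5 ℓ x y z Q≡8ℓ+5 = Q₂-mod8≢5 r s t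
  (∣x-y⇒∣y-z⇒∣x-z {x = Q₂ (+ toℕ r) (+ toℕ s) (+ toℕ t)} 8∣Q₂[r,s,t]-Q₂[x,y,z] 8∣Q₂[x,y,z]-5)
  where
  open ≡-Reasoning
  r = residue 4 x; s = residue 4 y; t = residue 4 z
  8∣Q₂[r,s,t]-Q₂[x,y,z] : + 8 ∣ Q₂ (+ toℕ r) (+ toℕ s) (+ toℕ t) - Q₂ x y z
  8∣Q₂[r,s,t]-Q₂[x,y,z] = Q₂-cong (+ 2) (+ toℕ r) (+ toℕ s) (+ toℕ t) x y z
    (∣residue-x 4 x) (∣residue-x 4 y) (∣residue-x 4 z)
  8∣Q₂[x,y,z]-5 : + 8 ∣ Q₂ x y z - + 5
  8∣Q₂[x,y,z]-5 = divides ℓ (begin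
    Q₂ x y z - + 5          ≡⟨ cong (_- + 5) Q≡8ℓ+5 ⟩
    + 8 * ℓ + + 5 - + 5     ≡⟨ identity ℓ ⟩
    ℓ * + 8                 ∎)
    where
    identity : ∀ (ℓ : ℤ) → + 8 * ℓ + + 5 - + 5 ≡ ℓ * + 8
    identity = solve-∀

4∣Q₂⇒even : ∀ x y z → + 4 ∣ Q₂ x y z →
             toℕ (residue 2 x) ≡ 0 × toℕ (residue 2 y) ≡ 0 × toℕ (residue 2 z) ≡ 0
4∣Q₂⇒even x y z 4∣Q = Q₂-mod4≡0⇒zero r s t (∣m+n∣n⇒∣m 4∣Q₂[r,s,t]-Q₂[x,y,z] (∣m⇒∣-m 4∣Q))
  where
  r = residue 2 x; s = residue 2 y; t = residue 2 z
  4∣Q₂[r,s,t]-Q₂[x,y,z] : + 4 ∣ Q₂ (+ toℕ r) (+ toℕ s) (+ toℕ t) - Q₂ x y z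
  4∣Q₂[r,s,t]-Q₂[x,y,z] = Q₂-cong (+ 1) (+ toℕ r) (+ toℕ s) (+ toℕ t) x y z
    (∣residue-x 2 x) (∣residue-x 2 y) (∣residue-x 2 z)

Q₂-halve : ∀ x y z → + 4 ∣ Q₂ x y z → Q₂ x y z ≡ + 4 * Q₂ (x /ℕ 2) (y /ℕ 2) (z /ℕ 2)
Q₂-halve x y z 4∣Q = let r≡0 , s≡0 , t≡0 = 4∣Q₂⇒even x y z 4∣Q in begin
  Q₂ x y z
    ≡⟨ cong₃ Q₂ (residue≡0⇒x≡quotient*d 2 x r≡0) (residue≡0⇒x≡quotient*d 2 y s≡0)
                (residue≡0⇒x≡quotient*d 2 z t≡0) ⟩
  Q₂ ((x /ℕ 2) * + 2) ((y /ℕ 2) * + 2) ((z /ℕ 2) * + 2)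
    ≡⟨ Q₂-*2 (x /ℕ 2) (y /ℕ 2) (z /ℕ 2) ⟩
  + 4 * Q₂ (x /ℕ 2) (y /ℕ 2) (z /ℕ 2) ∎
  where
  open ≡-Reasoning
  cong₃ : ∀ (f : ℤ → ℤ → ℤ → ℤ) {x x′ y y′ z z′} → x ≡ x′ → y ≡ y′ → z ≡ z′ → f x y z ≡ f x′ y′ z′
  cong₃ f refl refl refl = refl

Q₂≢4^k[8ℓ+5] : ∀ k ℓ x y z → Q₂ x y z ≢ + (4 ^ k) * (+ 8 * ℓ + + 5)
Q₂≢4^k[8ℓ+5] ℕ.zero    ℓ x y z Q≡ = Q₂≢8ℓ+5 ℓ x y z (trans Q≡ (*-identityˡ _))
Q₂≢4^k[8ℓ+5] (ℕ.suc k) ℓ x y z Q≡ =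
  Q₂≢4^k[8ℓ+5] k ℓ (x /ℕ 2) (y /ℕ 2) (z /ℕ 2)
    (*-cancelˡ-≡ (+ 4) _ _ (trans (sym (Q₂-halve x y z 4∣Q)) Q≡4n))
  where
  n = + (4 ^ k) * (+ 8 * ℓ + + 5)
  Q≡4n : Q₂ x y z ≡ + 4 * n
  Q≡4n = trans Q≡ (trans (cong (_* (+ 8 * ℓ + + 5)) (pos-* 4 (4 ^ k))) (*-assoc (+ 4) (+ (4 ^ k)) _))
  4∣Q : + 4 ∣ Q₂ x y z
  4∣Q = subst (+ 4 ∣_) (sym Q≡4n) (∣m⇒∣m*n n ∣-refl)

mainTheorem6 : (k : ℕ) (ℓ : ℤ) → ¬ RepresentedByQ₂ (+ (4 ^ k) * (+ 8 * ℓ + + 5))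
mainTheorem6 k ℓ (x , y , z , Q≡) = Q₂≢4^k[8ℓ+5] k ℓ x y z Q≡
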